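{- Let $d$ be a positive integer and $X$ a nonempty finite set of positive integers, and let $s = \sum_{x\in X} \frac{1}{x}$ and $n = \sum_{x\in X} x^d$. Then $$|X| \leq s\sqrt[d+1]{\frac{n}{s}}$$ and $$\left\lceil\frac{1}{s}\right\rceil \leq \min X \leq \left\lfloor \min\left\{ \sqrt[d+1]{\frac{n}{s}},\ \sqrt[d]{n} \right\} \right\rfloor.$$ -}

module Defs where

open import Data.Nat as ℕ using (ℕ; zero; suc; _⊓_)
open import Data.Integer as ℤ using (ℤ; +_; -[1+_])
open import Data.Rational using (ℚ; mkℚ; 0ℚ; 1ℚ; _+_; _*_; _/_; 1/_)
open import Data.List using (List; _∷_; []; foldr)

-- Multiplicative inverse on ℚ, with the (irrelevant here) convention 0⁻¹ = 0.
inv : ℚ → ℚ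
inv p@(mkℚ (+ zero) _ _)  = 0ℚ
inv p@(mkℚ (+ suc _) _ _) = 1/ p
inv p@(mkℚ -[1+ _ ] _ _)  = 1/ p

-- Reciprocal 1/x of a natural number (convention 1/0 = 0; only used for x > 0).
recipℕ : ℕ → ℚ
recipℕ zero    = 0ℚ
recipℕ (suc k) = + 1 / suc k

_^ℚ_ : ℚ → ℕ → ℚ
q ^ℚ zero  = 1ℚ
q ^ℚ suc k = q * (q ^ℚ k)

sumRecip : List ℕ → ℚ
sumRecip = foldr (λ x acc → recipℕ x + acc) 0ℚ

sumPow : ℕ → List ℕ → ℕ
sumPow d = foldr (λ x acc → x ℕ.^ d ℕ.+ acc) 0

minList : ℕ → List ℕ → ℕ
minList x xs = foldr _⊓_ x xs

-- r = ⌊ q^(1/k) ⌋ for q ≥ 0, k ≥ 1: r is the natural number with r^k ≤ q < (r+1)^k.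
IsFloorRoot : ℕ → ℚ → ℕ → Set
IsFloorRoot k q r =
  ((+ r / 1) ^ℚ k) Data.Rational.≤ q × q Data.Rational.< ((+ suc r / 1) ^ℚ k)
  where open import Data.Product using (_×_)

{-# OPTIONS --safe #-}
-- On X the sequences 1/x and x^(k+1) are oppositely ordered, so Chebyshev's sum
-- inequality gives |X| · Σ x^k ≤ s · Σ x^(k+1); telescoping from Σ x^0 = |X| yields
-- |X|^(d+1) ≤ s^d · n. For m = min X, one summand of s is 1/m, so 1 ≤ m s; and
-- s · m^(d+1) ≤ Σ x^(d+1)/x = n while m^d ≤ n, which bounds m by both floor roots.
module Submission where

open import Defs
open import Data.Nat as ℕ using (ℕ; zero; suc; _⊓_)
import Data.Nat.Properties as ℕP
import Data.Nat.Coprimality as Coprime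
open import Data.Integer as ℤ using (+_)
import Data.Integer.Properties as ℤP
open import Data.Integer.DivMod using (div-pos-is-/ℕ; n<s[n/ℕd]*d)
open import Data.Rational
  using (ℚ; mkℚ; 0ℚ; 1ℚ; _+_; _*_; _-_; _/_; 1/_; _≤_; _<_; -_; *≤*; *<*; ceiling; ↥_; ↧_; ↧ₙ_; nonNegative)
open import Data.Rational.Properties
open import Data.Rational.Solver using (module +-*-Solver)
open import Data.List using (List; []; _∷_; length; foldr)
open import Data.List.Relation.Unary.All as All using (All; []; _∷_)
import Data.List.Relation.Unary.Any as Any
open import Data.List.Relation.Unary.Unique.Propositional using (Unique)
open import Data.List.Membership.Propositional using (_∈_)
open import Data.List.Membership.Propositional.Properties using (foldr-selective)
open import Data.List.Properties using (foldr-preservesᵒ)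
open import Data.Product using (_×_; _,_)
open import Data.Sum using (_⊎_; inj₁; inj₂; [_,_]′)
open import Relation.Binary.PropositionalEquality
  using (_≡_; refl; sym; trans; cong; cong₂; subst; subst₂; module ≡-Reasoning)
open import Algebra.Bundles using (CommutativeMonoid)
open import Algebra.Properties.CommutativeSemigroup (CommutativeMonoid.commutativeSemigroup *-1-commutativeMonoid)
  using (x∙yz≈y∙xz; x∙yz≈yx∙z)
open +-*-Solver using (solve; _:+_; _:-_; _:*_; _:=_; con)

fromℕ : ℕ → ℚ
fromℕ n = + n / 1

fromℕ≡mkℚ : ∀ n → fromℕ n ≡ mkℚ (+ n) 0 (Coprime.sym (Coprime.1-coprimeTo n))
fromℕ≡mkℚ n = normalize-coprime _

fromℕ-homo-+ : ∀ m n → fromℕ (m ℕ.+ n) ≡ fromℕ m + fromℕ n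
fromℕ-homo-+ m n rewrite fromℕ≡mkℚ m | fromℕ≡mkℚ n =
  cong (_/ 1) (trans (ℤP.pos-+ m n)
    (sym (cong₂ ℤ._+_ (ℤP.*-identityʳ (+ m)) (ℤP.*-identityʳ (+ n)))))

fromℕ-homo-* : ∀ m n → fromℕ (m ℕ.* n) ≡ fromℕ m * fromℕ n
fromℕ-homo-* m n rewrite fromℕ≡mkℚ m | fromℕ≡mkℚ n = cong (_/ 1) (ℤP.pos-* m n)

fromℕ-homo-^ : ∀ m k → fromℕ (m ℕ.^ k) ≡ fromℕ m ^ℚ k
fromℕ-homo-^ m zero    = refl
fromℕ-homo-^ m (suc k) = trans (fromℕ-homo-* m (m ℕ.^ k)) (cong (fromℕ m *_) (fromℕ-homo-^ m k))

fromℕ-mono-≤ : ∀ {m n} → m ℕ.≤ n → fromℕ m ≤ fromℕ n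
fromℕ-mono-≤ {m} {n} m≤n rewrite fromℕ≡mkℚ m | fromℕ≡mkℚ n =
  *≤* (subst₂ ℤ._≤_ (sym (ℤP.*-identityʳ (+ m))) (sym (ℤP.*-identityʳ (+ n))) (ℤ.+≤+ m≤n))

fromℕ-cancel-< : ∀ {m n} → fromℕ m < fromℕ n → m ℕ.< n
fromℕ-cancel-< {m} {n} m<n rewrite fromℕ≡mkℚ m | fromℕ≡mkℚ n with m<n
... | *<* m*1<n*1 = ℤP.drop‿+<+ (subst₂ ℤ._<_ (ℤP.*-identityʳ (+ m)) (ℤP.*-identityʳ (+ n)) m*1<n*1)

fromℕ-nonNeg : ∀ n → 0ℚ ≤ fromℕ n
fromℕ-nonNeg n = fromℕ-mono-≤ {0} {n} ℕ.z≤n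

fromℕ-^-mono-≤ : ∀ k {m n} → m ℕ.≤ n → fromℕ m ^ℚ k ≤ fromℕ n ^ℚ k
fromℕ-^-mono-≤ k {m} {n} m≤n =
  subst₂ _≤_ (fromℕ-homo-^ m k) (fromℕ-homo-^ n k) (fromℕ-mono-≤ (ℕP.^-monoˡ-≤ k m≤n))

*-nonNeg : ∀ {p q} → 0ℚ ≤ p → 0ℚ ≤ q → 0ℚ ≤ p * q
*-nonNeg {p} {q} 0≤p 0≤q = subst (_≤ p * q) (*-zeroʳ p) (*-monoˡ-≤-nonNeg p {{nonNegative 0≤p}} 0≤q)

^ℚ-nonNeg : ∀ {p} k → 0ℚ ≤ p → 0ℚ ≤ p ^ℚ k
^ℚ-nonNeg zero    _   = *≤* (ℤ.+≤+ ℕ.z≤n)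
^ℚ-nonNeg (suc k) 0≤p = *-nonNeg 0≤p (^ℚ-nonNeg k 0≤p)

recipℕ-suc≡mkℚ : ∀ k → recipℕ (suc k) ≡ mkℚ (+ 1) k (Coprime.1-coprimeTo (suc k))
recipℕ-suc≡mkℚ k = normalize-coprime (Coprime.1-coprimeTo (suc k))

recipℕ-inverseˡ : ∀ {n} → 0 ℕ.< n → recipℕ n * fromℕ n ≡ 1ℚ
recipℕ-inverseˡ {suc k} _ rewrite fromℕ≡mkℚ (suc k) | recipℕ-suc≡mkℚ k =
  *-inverseˡ (mkℚ (+ suc k) 0 (Coprime.sym (Coprime.1-coprimeTo (suc k))))

recipℕ-positive : ∀ {n} → 0 ℕ.< n → 0ℚ < recipℕ n
recipℕ-positive {suc k} _ rewrite recipℕ-suc≡mkℚ k = positive⁻¹ _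

recipℕ-nonNeg : ∀ n → 0ℚ ≤ recipℕ n
recipℕ-nonNeg zero    = ≤-refl
recipℕ-nonNeg (suc k) = <⇒≤ (recipℕ-positive {suc k} ℕ.z<s)

recipℕ-antitone : ∀ {m n} → 0 ℕ.< m → m ℕ.≤ n → recipℕ n ≤ recipℕ m
recipℕ-antitone {suc a} {suc b} _ m≤n
  rewrite recipℕ-suc≡mkℚ a | recipℕ-suc≡mkℚ b =
  *≤* (subst₂ ℤ._≤_ (sym (ℤP.*-identityˡ (+ suc a))) (sym (ℤP.*-identityˡ (+ suc b))) (ℤ.+≤+ m≤n))

recipℕ-*-^-suc : ∀ {n} k → 0 ℕ.< n → recipℕ n * fromℕ n ^ℚ suc k ≡ fromℕ n ^ℚ k
recipℕ-*-^-suc {n} k 0<n = begin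
  recipℕ n * (fromℕ n * fromℕ n ^ℚ k)  ≡⟨ *-assoc (recipℕ n) (fromℕ n) _ ⟨
  recipℕ n * fromℕ n * fromℕ n ^ℚ k    ≡⟨ cong (_* fromℕ n ^ℚ k) (recipℕ-inverseˡ 0<n) ⟩
  1ℚ * fromℕ n ^ℚ k                     ≡⟨ *-identityˡ _ ⟩
  fromℕ n ^ℚ k                          ∎
  where open ≡-Reasoning

inv-inverseʳ : ∀ {p} → 0ℚ < p → p * inv p ≡ 1ℚ
inv-inverseʳ {p@(mkℚ (ℤ.+[1+ _ ]) _ _)} _ = *-inverseʳ p
inv-inverseʳ {mkℚ ℤ.+0 _ _} (*<* (ℤ.+<+ ()))
inv-inverseʳ {mkℚ ℤ.-[1+ _ ] _ _} (*<* ())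

inv-nonNeg : ∀ {p} → 0ℚ < p → 0ℚ ≤ inv p
inv-nonNeg {p@(mkℚ (ℤ.+[1+ _ ]) _ _)} _ = nonNegative⁻¹ (1/ p)
inv-nonNeg {mkℚ ℤ.+0 _ _} (*<* (ℤ.+<+ ()))
inv-nonNeg {mkℚ ℤ.-[1+ _ ] _ _} (*<* ())

*-≤⇒≤-*-inv : ∀ {p q r} → 0ℚ < p → p * q ≤ r → q ≤ r * inv p
*-≤⇒≤-*-inv {p} {q} {r} 0<p pq≤r = begin
  q                ≡⟨ *-identityʳ q ⟨
  q * 1ℚ           ≡⟨ cong (q *_) (inv-inverseʳ 0<p) ⟨
  q * (p * inv p)  ≡⟨ solve 3 (λ p q w → q :* (p :* w) := (p :* q) :* w) refl p q (inv p) ⟩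
  p * q * inv p    ≤⟨ *-monoʳ-≤-nonNeg (inv p) {{nonNegative (inv-nonNeg 0<p)}} pq≤r ⟩
  r * inv p        ∎
  where open ≤-Reasoning

inv-≤ : ∀ {p q} → 0ℚ < p → 1ℚ ≤ p * q → inv p ≤ q
inv-≤ {p} {q} 0<p 1≤pq = begin
  inv p              ≡⟨ *-identityʳ (inv p) ⟨
  inv p * 1ℚ         ≤⟨ *-monoˡ-≤-nonNeg (inv p) {{nonNegative (inv-nonNeg 0<p)}} 1≤pq ⟩
  inv p * (p * q)    ≡⟨ solve 3 (λ p q w → w :* (p :* q) := (p :* w) :* q) refl p q (inv p) ⟩
  p * inv p * q      ≡⟨ cong (_* q) (inv-inverseʳ 0<p) ⟩
  1ℚ * q             ≡⟨ *-identityˡ q ⟩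
  q                  ∎
  where open ≤-Reasoning

^-suc-*-*-inv : ∀ {p} k r → 0ℚ < p → p ^ℚ suc k * (r * inv p) ≡ p ^ℚ k * r
^-suc-*-*-inv {p} k r 0<p = begin
  p * p ^ℚ k * (r * inv p)    ≡⟨ solve 4 (λ p pᵏ r w → p :* pᵏ :* (r :* w) := pᵏ :* r :* (p :* w)) refl p (p ^ℚ k) r (inv p) ⟩
  p ^ℚ k * r * (p * inv p)    ≡⟨ cong (p ^ℚ k * r *_) (inv-inverseʳ 0<p) ⟩
  p ^ℚ k * r * 1ℚ             ≡⟨ *-identityʳ _ ⟩
  p ^ℚ k * r                  ∎
  where open ≡-Reasoning

∑ : {A : Set} → List A → (A → ℚ) → ℚ
∑ L f = foldr (λ x acc → f x + acc) 0ℚ L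

module _ {A : Set} where

  ∑-nonNeg : ∀ {f : A → ℚ} → (∀ x → 0ℚ ≤ f x) → ∀ L → 0ℚ ≤ ∑ L f
  ∑-nonNeg f≥0 []      = ≤-refl
  ∑-nonNeg f≥0 (x ∷ L) = +-mono-≤ (f≥0 x) (∑-nonNeg f≥0 L)

  ∈⇒≤∑ : ∀ {f : A → ℚ} {y L} → (∀ x → 0ℚ ≤ f x) → y ∈ L → f y ≤ ∑ L f
  ∈⇒≤∑ {f} {y} {_ ∷ L} f≥0 (Any.here refl) =
    subst (_≤ f y + ∑ L f) (+-identityʳ (f y)) (+-monoʳ-≤ (f y) (∑-nonNeg f≥0 L))
  ∈⇒≤∑ {f} {y} {x ∷ L} f≥0 (Any.there y∈L) =
    subst (_≤ f x + ∑ L f) (+-identityˡ (f y)) (+-mono-≤ (f≥0 x) (∈⇒≤∑ f≥0 y∈L))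

  ∑-cong : ∀ {f g : A → ℚ} {L} → All (λ x → f x ≡ g x) L → ∑ L f ≡ ∑ L g
  ∑-cong []           = refl
  ∑-cong (fx≡gx ∷ eqs) = cong₂ _+_ fx≡gx (∑-cong eqs)

  ∑-mono-≤ : ∀ {f g : A → ℚ} {L} → All (λ x → f x ≤ g x) L → ∑ L f ≤ ∑ L g
  ∑-mono-≤ []             = ≤-refl
  ∑-mono-≤ (fx≤gx ∷ ineqs) = +-mono-≤ fx≤gx (∑-mono-≤ ineqs)

  ∑-*ʳ : ∀ (f : A → ℚ) c L → ∑ L f * c ≡ ∑ L (λ x → f x * c)
  ∑-*ʳ f c []      = *-zeroˡ c
  ∑-*ʳ f c (x ∷ L) = trans (*-distribʳ-+ c (f x) (∑ L f)) (cong (_+_ (f x * c)) (∑-*ʳ f c L))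

  ∑-1≡length : ∀ (L : List A) → ∑ L (λ _ → 1ℚ) ≡ fromℕ (length L)
  ∑-1≡length []      = refl
  ∑-1≡length (x ∷ L) = trans (cong (_+_ 1ℚ) (∑-1≡length L)) (sym (fromℕ-homo-+ 1 (length L)))

rearrangement : ∀ {a b c d} → a ≤ b → c ≤ d → a * d + b * c ≤ a * c + b * d
rearrangement {a} {b} {c} {d} a≤b c≤d = begin
  a * d + b * c                          ≡⟨ +-identityʳ _ ⟨
  a * d + b * c + 0ℚ                     ≤⟨ +-monoʳ-≤ (a * d + b * c) (*-nonNeg (diff-nonNeg a≤b) (diff-nonNeg c≤d)) ⟩
  a * d + b * c + (b - a) * (d - c)      ≡⟨ solve 4 (λ a b c d → a :* d :+ b :* c :+ (b :- a) :* (d :- c) := a :* c :+ b :* d) refl a b c d ⟩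
  a * c + b * d                          ∎
  where
  open ≤-Reasoning
  diff-nonNeg : ∀ {p q} → p ≤ q → 0ℚ ≤ q - p
  diff-nonNeg {p} {q} p≤q = subst (_≤ q - p) (+-inverseʳ p) (+-monoˡ-≤ (- p) p≤q)

-- The pairwise form of (f x - f y) * (g x - g y) ≤ 0.
OppositelyOrderedOn : {A : Set} → (A → Set) → (f g : A → ℚ) → Set
OppositelyOrderedOn P f g = ∀ {x y} → P x → P y → f x * g x + f y * g y ≤ f x * g y + f y * g x

antitone-monotone⇒oppositelyOrdered : ∀ {P : ℕ → Set} {f g : ℕ → ℚ} →
  (∀ {x y} → P x → x ℕ.≤ y → f y ≤ f x) → (∀ {x y} → P x → x ℕ.≤ y → g x ≤ g y) →
  OppositelyOrderedOn P f g
antitone-monotone⇒oppositelyOrdered {f = f} {g} f↓ g↑ {x} {y} px py with ℕP.≤-total x y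
... | inj₁ x≤y = subst₂ _≤_ (+-comm (f y * g y) (f x * g x)) (+-comm (f y * g x) (f x * g y))
                   (rearrangement (f↓ px x≤y) (g↑ px x≤y))
... | inj₂ y≤x = rearrangement (f↓ py y≤x) (g↑ py y≤x)

module _ {A : Set} {P : A → Set} {f g : A → ℚ} (opposite : OppositelyOrderedOn P f g) where

  chebyshev-cross : ∀ {x L} → P x → All P L →
    ∑ L (λ y → f y * g y) + fromℕ (length L) * (f x * g x) ≤ g x * ∑ L f + f x * ∑ L g
  chebyshev-cross {x} {[]} _ [] = ≤-reflexive
    (solve 3 (λ a b c → con 0ℚ :+ con 0ℚ :* a := b :* con 0ℚ :+ c :* con 0ℚ) refl (f x * g x) (g x) (f x))
  chebyshev-cross {x} {y ∷ L} px (py ∷ pL) = begin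
    (fy * gy + Sfg) + fromℕ (suc (length L)) * (fx * gx)
      ≡⟨ cong (λ n → (fy * gy + Sfg) + n * (fx * gx)) (fromℕ-homo-+ 1 (length L)) ⟩
    (fy * gy + Sfg) + (1ℚ + N) * (fx * gx)
      ≡⟨ solve 6 (λ fx gx fy gy Sfg N →
           (fy :* gy :+ Sfg) :+ (con 1ℚ :+ N) :* (fx :* gx)
             := (fx :* gx :+ fy :* gy) :+ (Sfg :+ N :* (fx :* gx))) refl fx gx fy gy Sfg N ⟩
    (fx * gx + fy * gy) + (Sfg + N * (fx * gx))
      ≤⟨ +-mono-≤ (opposite px py) (chebyshev-cross px pL) ⟩
    (fx * gy + fy * gx) + (gx * Sf + fx * Sg)
      ≡⟨ solve 6 (λ fx gx fy gy Sf Sg →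
           (fx :* gy :+ fy :* gx) :+ (gx :* Sf :+ fx :* Sg)
             := gx :* (fy :+ Sf) :+ fx :* (gy :+ Sg)) refl fx gx fy gy Sf Sg ⟩
    gx * (fy + Sf) + fx * (gy + Sg)
      ∎
    where
    open ≤-Reasoning
    fx = f x; gx = g x; fy = f y; gy = g y
    N = fromℕ (length L); Sf = ∑ L f; Sg = ∑ L g; Sfg = ∑ L (λ z → f z * g z)

  chebyshev : ∀ {L} → All P L → fromℕ (length L) * ∑ L (λ x → f x * g x) ≤ ∑ L f * ∑ L g
  chebyshev {[]} [] = ≤-refl
  chebyshev {x ∷ L} (px ∷ pL) = begin
    fromℕ (suc (length L)) * (fx * gx + Sfg)
      ≡⟨ cong (_* (fx * gx + Sfg)) (fromℕ-homo-+ 1 (length L)) ⟩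
    (1ℚ + N) * (fx * gx + Sfg)
      ≡⟨ solve 4 (λ fx gx Sfg N →
           (con 1ℚ :+ N) :* (fx :* gx :+ Sfg)
             := fx :* gx :+ ((Sfg :+ N :* (fx :* gx)) :+ N :* Sfg)) refl fx gx Sfg N ⟩
    fx * gx + ((Sfg + N * (fx * gx)) + N * Sfg)
      ≤⟨ +-monoʳ-≤ (fx * gx) (+-mono-≤ (chebyshev-cross px pL) (chebyshev pL)) ⟩
    fx * gx + ((gx * Sf + fx * Sg) + Sf * Sg)
      ≡⟨ solve 4 (λ fx gx Sf Sg →
           fx :* gx :+ ((gx :* Sf :+ fx :* Sg) :+ Sf :* Sg) := (fx :+ Sf) :* (gx :+ Sg)) refl fx gx Sf Sg ⟩
    (fx + Sf) * (gx + Sg)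
      ∎
    where
    open ≤-Reasoning
    fx = f x; gx = g x
    N = fromℕ (length L); Sf = ∑ L f; Sg = ∑ L g; Sfg = ∑ L (λ z → f z * g z)

pow-≤-telescope : ∀ {N s} (a : ℕ → ℚ) → 0ℚ ≤ N → 0ℚ ≤ s → a 0 ≡ N →
  (∀ k → N * a k ≤ s * a (suc k)) → ∀ k → N ^ℚ suc k ≤ s ^ℚ k * a k
pow-≤-telescope {N} {s} a 0≤N 0≤s a₀≡N step zero = ≤-reflexive (begin
  N * 1ℚ   ≡⟨ *-identityʳ N ⟩
  N        ≡⟨ a₀≡N ⟨
  a 0      ≡⟨ *-identityˡ (a 0) ⟨
  1ℚ * a 0 ∎)
  where open ≡-Reasoning
pow-≤-telescope {N} {s} a 0≤N 0≤s a₀≡N step (suc k) = begin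
  N * N ^ℚ suc k              ≤⟨ *-monoˡ-≤-nonNeg N {{nonNegative 0≤N}} (pow-≤-telescope a 0≤N 0≤s a₀≡N step k) ⟩
  N * (s ^ℚ k * a k)          ≡⟨ x∙yz≈y∙xz N (s ^ℚ k) (a k) ⟩
  s ^ℚ k * (N * a k)          ≤⟨ *-monoˡ-≤-nonNeg (s ^ℚ k) {{nonNegative (^ℚ-nonNeg k 0≤s)}} (step k) ⟩
  s ^ℚ k * (s * a (suc k))    ≡⟨ x∙yz≈yx∙z (s ^ℚ k) s (a (suc k)) ⟩
  s * s ^ℚ k * a (suc k)      ∎
  where open ≤-Reasoning

powerSum : ℕ → List ℕ → ℚ
powerSum k L = ∑ L (λ x → fromℕ x ^ℚ k)

fromℕ-sumPow : ∀ k L → fromℕ (sumPow k L) ≡ powerSum k L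
fromℕ-sumPow k []      = refl
fromℕ-sumPow k (x ∷ L) =
  trans (fromℕ-homo-+ (x ℕ.^ k) (sumPow k L)) (cong₂ _+_ (fromℕ-homo-^ x k) (fromℕ-sumPow k L))

length-*-powerSum≤sumRecip-*-powerSum : ∀ k {L} → All (0 ℕ.<_) L →
  fromℕ (length L) * powerSum k L ≤ sumRecip L * powerSum (suc k) L
length-*-powerSum≤sumRecip-*-powerSum k {L} positive =
  subst (λ S → fromℕ (length L) * S ≤ sumRecip L * powerSum (suc k) L)
    (∑-cong (All.map (recipℕ-*-^-suc k) positive))
    (chebyshev {f = recipℕ} {g = λ x → fromℕ x ^ℚ suc k}
      (antitone-monotone⇒oppositelyOrdered recipℕ-antitone (λ _ → fromℕ-^-mono-≤ (suc k))) positive)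

length-^-suc≤sumRecip-^-*-powerSum : ∀ k {L} → All (0 ℕ.<_) L →
  fromℕ (length L) ^ℚ suc k ≤ sumRecip L ^ℚ k * powerSum k L
length-^-suc≤sumRecip-^-*-powerSum k {L} positive =
  pow-≤-telescope (λ j → powerSum j L) (fromℕ-nonNeg (length L)) (∑-nonNeg recipℕ-nonNeg L)
    (∑-1≡length L) (λ j → length-*-powerSum≤sumRecip-*-powerSum j positive) k

sumRecip-*-^-suc≤powerSum : ∀ k {m L} → All (0 ℕ.<_) L → All (m ℕ.≤_) L →
  sumRecip L * fromℕ m ^ℚ suc k ≤ powerSum k L
sumRecip-*-^-suc≤powerSum k {m} {L} positive m≤L = begin
  sumRecip L * fromℕ m ^ℚ suc k               ≡⟨ ∑-*ʳ recipℕ (fromℕ m ^ℚ suc k) L ⟩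
  ∑ L (λ x → recipℕ x * fromℕ m ^ℚ suc k)     ≤⟨ ∑-mono-≤ (All.zipWith termwise (positive , m≤L)) ⟩
  powerSum k L                                 ∎
  where
  open ≤-Reasoning
  termwise : ∀ {x} → 0 ℕ.< x × m ℕ.≤ x → recipℕ x * fromℕ m ^ℚ suc k ≤ fromℕ x ^ℚ k
  termwise {x} (0<x , m≤x) = begin
    recipℕ x * fromℕ m ^ℚ suc k  ≤⟨ *-monoˡ-≤-nonNeg (recipℕ x) {{nonNegative (recipℕ-nonNeg x)}} (fromℕ-^-mono-≤ (suc k) m≤x) ⟩
    recipℕ x * fromℕ x ^ℚ suc k  ≡⟨ recipℕ-*-^-suc k 0<x ⟩
    fromℕ x ^ℚ k                 ∎

minList∈ : ∀ x xs → minList x xs ∈ x ∷ xs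
minList∈ x xs = [ Any.here , Any.there ]′ (foldr-selective ℕP.⊓-sel x xs)

∈⇒minList≤ : ∀ {y} x xs → y ∈ x ∷ xs → minList x xs ℕ.≤ y
∈⇒minList≤ {y} x xs y∈ = foldr-preservesᵒ
  (λ a b → [ ℕP.m≤n⇒m⊓o≤n b , ℕP.m≤n⇒o⊓m≤n a ]′) x xs (bound y∈)
  where
  bound : y ∈ x ∷ xs → x ℕ.≤ y ⊎ Any.Any (ℕ._≤ y) xs
  bound (Any.here y≡x)  = inj₁ (ℕP.≤-reflexive (sym y≡x))
  bound (Any.there y∈xs) = inj₂ (Any.map (λ y≡z → ℕP.≤-reflexive (sym y≡z)) y∈xs)

^-cancelˡ-< : ∀ k {m n} → m ℕ.^ k ℕ.< n ℕ.^ k → m ℕ.< n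
^-cancelˡ-< k mᵏ<nᵏ = ℕP.≰⇒> (λ n≤m → ℕP.<⇒≱ mᵏ<nᵏ (ℕP.^-monoˡ-≤ k n≤m))

isFloorRoot-greatest : ∀ k {q r m} → IsFloorRoot k q r → fromℕ m ^ℚ k ≤ q → m ℕ.≤ r
isFloorRoot-greatest k {q} {r} {m} (_ , q<[r+1]ᵏ) mᵏ≤q = ℕ.s≤s⁻¹ (^-cancelˡ-< k (fromℕ-cancel-< (begin-strict
  fromℕ (m ℕ.^ k)       ≡⟨ fromℕ-homo-^ m k ⟩
  fromℕ m ^ℚ k          ≤⟨ mᵏ≤q ⟩
  q                     <⟨ q<[r+1]ᵏ ⟩
  fromℕ (suc r) ^ℚ k    ≡⟨ fromℕ-homo-^ (suc r) k ⟨
  fromℕ (suc r ℕ.^ k)   ∎)))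
  where open ≤-Reasoning

≤-/ℕ : ∀ {i j} d .{{_ : ℕ.NonZero d}} → i ℤ.* + d ℤ.≤ j → i ℤ.≤ j ℤ./ℕ d
≤-/ℕ {i} {j} d i*d≤j = subst (i ℤ.≤_) (ℤP.pred-suc (j ℤ./ℕ d)) (ℤP.i<j⇒i≤pred[j] {j = ℤ.suc (j ℤ./ℕ d)}
  (ℤP.*-cancelʳ-<-nonNeg (+ d) (ℤP.≤-<-trans i*d≤j (n<s[n/ℕd]*d j d))))

ceiling≡ : ∀ p → ceiling p ≡ ℤ.- ((ℤ.- ↥ p) ℤ./ℕ ↧ₙ p)
ceiling≡ (mkℚ ℤ.+0       b _) = cong ℤ.-_ (div-pos-is-/ℕ ℤ.+0 (suc b))
ceiling≡ (mkℚ ℤ.+[1+ n ] b _) = cong ℤ.-_ (div-pos-is-/ℕ ℤ.-[1+ n ] (suc b))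
ceiling≡ (mkℚ ℤ.-[1+ n ] b _) = cong ℤ.-_ (div-pos-is-/ℕ ℤ.+[1+ n ] (suc b))

ceiling≤ : ∀ {p} m → p ≤ fromℕ m → ceiling p ℤ.≤ + m
ceiling≤ {p} m p≤m with subst (p ≤_) (fromℕ≡mkℚ m) p≤m
... | *≤* ↥p*1≤m*↧p = begin
  ceiling p                          ≡⟨ ceiling≡ p ⟩
  ℤ.- ((ℤ.- ↥ p) ℤ./ℕ ↧ₙ p)         ≤⟨ ℤP.neg-mono-≤ (≤-/ℕ (↧ₙ p) -m*↧p≤-↥p) ⟩
  ℤ.- ℤ.- + m                        ≡⟨ ℤP.neg-involutive (+ m) ⟩
  + m                                ∎
  where
  open ℤP.≤-Reasoning
  -m*↧p≤-↥p : ℤ.- + m ℤ.* ↧ p ℤ.≤ ℤ.- ↥ p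
  -m*↧p≤-↥p = subst₂ ℤ._≤_ (ℤP.neg-distribˡ-* (+ m) (↧ p)) (cong ℤ.-_ (ℤP.*-identityʳ (↥ p)))
    (ℤP.neg-mono-≤ ↥p*1≤m*↧p)

lemma1 : (d : ℕ) → 1 ℕ.≤ d → (x₀ : ℕ) → (xs : List ℕ) →
           Unique (x₀ ∷ xs) → All (λ x → 1 ℕ.≤ x) (x₀ ∷ xs) →
           let X = x₀ ∷ xs
               s = sumRecip X
               n = sumPow d X
               m = minList x₀ xs
           in ((+ length X / 1) ^ℚ suc d ≤ (s ^ℚ suc d) * ((+ n / 1) * inv s))
              × (ceiling (inv s) ℤ.≤ + m)
              × ((r₁ r₂ : ℕ) → IsFloorRoot (suc d) ((+ n / 1) * inv s) r₁ →
                   IsFloorRoot d (+ n / 1) r₂ → m ℕ.≤ r₁ ⊓ r₂)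
lemma1 d _ x₀ xs _ positive = length-bound , ceiling-bound , root-bound
  where
  X : List ℕ
  X = x₀ ∷ xs
  s : ℚ
  s = sumRecip X
  n m : ℕ
  n = sumPow d X
  m = minList x₀ xs
  m∈X : m ∈ X
  m∈X = minList∈ x₀ xs
  m≤X : All (m ℕ.≤_) X
  m≤X = All.tabulate (∈⇒minList≤ x₀ xs)
  0<s : 0ℚ < s
  0<s = <-≤-trans (recipℕ-positive (All.head positive)) (∈⇒≤∑ {y = x₀} {L = X} recipℕ-nonNeg (Any.here refl))

  length-bound : fromℕ (length X) ^ℚ suc d ≤ s ^ℚ suc d * (fromℕ n * inv s)
  length-bound = subst (fromℕ (length X) ^ℚ suc d ≤_)
    (trans (cong (s ^ℚ d *_) (sym (fromℕ-sumPow d X))) (sym (^-suc-*-*-inv d (fromℕ n) 0<s)))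
    (length-^-suc≤sumRecip-^-*-powerSum d positive)

  ceiling-bound : ceiling (inv s) ℤ.≤ + m
  ceiling-bound = ceiling≤ m (inv-≤ 0<s (subst (_≤ s * fromℕ m) (recipℕ-inverseˡ (All.lookup positive m∈X))
    (*-monoʳ-≤-nonNeg (fromℕ m) {{nonNegative (fromℕ-nonNeg m)}} (∈⇒≤∑ recipℕ-nonNeg m∈X))))

  root-bound : (r₁ r₂ : ℕ) → IsFloorRoot (suc d) (fromℕ n * inv s) r₁ → IsFloorRoot d (fromℕ n) r₂ → m ℕ.≤ r₁ ⊓ r₂
  root-bound r₁ r₂ root₁ root₂ = ℕP.⊓-glb
    (isFloorRoot-greatest (suc d) root₁ (*-≤⇒≤-*-inv 0<s
      (subst (s * fromℕ m ^ℚ suc d ≤_) (sym (fromℕ-sumPow d X)) (sumRecip-*-^-suc≤powerSum d positive m≤X))))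
    (isFloorRoot-greatest d root₂ (subst (_≤ fromℕ n) (fromℕ-homo-^ m d)
      (fromℕ-mono-≤ (ℕP.≤-trans (ℕP.^-monoˡ-≤ d (All.head m≤X)) (ℕP.m≤m+n (x₀ ℕ.^ d) (sumPow d xs))))))
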